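{- There is a constant $C>0$ such that for every integer $n\ge 2$, the class of all connected $n$-vertex graphs has a distance-vector labelling scheme with labels of at most $4n+C\log n$ bits.
   Context: $d_G(u,v)$ is the distance in $G$; $\log$ is the binary logarithm. A distance-vector labelling scheme for a class $\mathcal{C}$ with labels of at most $k$ bits is a function $D:\{0,1\}^*\to(\mathbb{N}\cup\{\infty\})^*$ (from finite binary strings to finite sequences over $\mathbb{N}\cup\{\infty\}$) such that for every $G\in\mathcal{C}$ there exist an ordering $v_1,\dots,v_n$ of $V(G)$ and a function $\ell_G:V(G)\to\{0,1\}^*$ with $|\ell_G(v)|\le k$ for all $v$, such that $D(\ell_G(v))=(d_G(v,v_1),\dots,d_G(v,v_n))$ for every $v\in V(G)$. -}

module Defs where

open import Data.Nat using (ℕ; zero; suc; _<_; _≤_; _+_; _*_)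
open import Data.Nat.Logarithm using (⌊log₂_⌋)
open import Data.Fin using (Fin)
open import Data.Bool using (Bool; true)
open import Data.Maybe using (Maybe; just; nothing)
open import Data.List using (List; length; tabulate)
open import Data.List.Relation.Binary.Pointwise using (Pointwise)
open import Data.Fin.Permutation using (Permutation′; _⟨$⟩ʳ_)
open import Data.Product using (Σ; ∃; _×_)
open import Relation.Binary.PropositionalEquality using (_≡_)
open import Relation.Nullary using (¬_)

record Graph (n : ℕ) : Set where
  field
    adj   : Fin n → Fin n → Bool
    sym   : ∀ u v → adj u v ≡ adj v u
    irref : ∀ u → ¬ (adj u u ≡ true)
open Graph public

data Walk {n : ℕ} (G : Graph n) : Fin n → Fin n → ℕ → Set where
  here : ∀ u → Walk G u u zero
  step : ∀ {u w v k} → adj G u w ≡ true → Walk G w v k → Walk G u v (suc k)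

Connected : ∀ {n} → Graph n → Set
Connected G = ∀ u v → ∃ λ k → Walk G u v k

-- ℕ ∪ {∞}: nothing represents ∞.
ℕ∞ : Set
ℕ∞ = Maybe ℕ

IsDist : ∀ {n} → Graph n → Fin n → Fin n → ℕ∞ → Set
IsDist G u v (just k) = Walk G u v k × (∀ m → m < k → ¬ Walk G u v m)
IsDist G u v nothing  = ∀ m → ¬ Walk G u v m

DistVecScheme : ℕ → ℕ → Set
DistVecScheme n k =
  Σ (List Bool → List ℕ∞) λ D →
    ∀ (G : Graph n) → Connected G →
      Σ (Permutation′ n) λ σ →          -- ordering v_i = σ ⟨$⟩ʳ i
      Σ (Fin n → List Bool) λ ℓ →
        (∀ v → length (ℓ v) ≤ k) ×
        (∀ v → Pointwise (λ d w → IsDist G v w d) (D (ℓ v)) (tabulate (σ ⟨$⟩ʳ_)))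

-- Fix a root and a depth-first traversal of the graph.  The traversal is a
-- walk of at most 2(n-1) moves, each either a step along an edge to a new
-- vertex or a return to the vertex on top of the stack; the order of first
-- visits is the vertex ordering of the scheme.  Along an edge, d(v,-) changes
-- by -1, 0 or +1, so the label of v records d(v,root) in binary followed by 2
-- bits per move: the change of d(v,-) on a forward step, or "back", which the
-- decoder resolves by keeping a stack of the distances it has computed.
module Submission where

open import Defs hiding (sym)
open import Data.Nat using (ℕ; zero; suc; _<_; _≤_; _+_; _*_; _∸_; _^_; z≤n; s≤s; _<?_)
import Data.Nat as ℕ
open import Data.Nat.Properties
open import Data.Nat.Induction using (<-rec)
open import Data.Nat.Logarithm using (⌊log₂_⌋; ⌊log₂⌋-mono-≤; ⌊log₂[2^n]⌋≡n)
open import Data.Nat.Tactic.RingSolver using (solve-∀)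
open import Data.Bool using (Bool; true; false; if_then_else_)
import Data.Bool.Properties as Bool
open import Data.Fin using (Fin; cast) renaming (zero to fzero; suc to fsuc)
open import Data.Fin.Properties using (any?; cast-is-id; injective⇒≤) renaming (_≟_ to _≟ᶠ_)
open import Data.Fin.Permutation using (Permutation; Permutation′; permutation; _⟨$⟩ʳ_; cast-id; _∘ₚ_; ↔⇒≡)
open import Data.Maybe using (just)
open import Data.List using (List; []; _∷_; _++_; [_]; length; lookup; tabulate; map)
open import Data.List.Properties using (length-++; ++-assoc; ++-identityʳ; tabulate-cong; tabulate-lookup)
open import Data.List.Membership.Propositional using (_∈_; _∉_)
open import Data.List.Membership.Propositional.Properties using (∈-lookup; ∈-++⁺ˡ; ∈-++⁺ʳ; ∈-++⁻)
open import Data.List.Relation.Unary.Any using (here; there; index)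
open import Data.List.Relation.Unary.Any.Properties using (lookup-index)
open import Data.List.Relation.Unary.All using (All; []; _∷_)
import Data.List.Relation.Unary.All as All
open import Data.List.Relation.Unary.All.Properties using (¬Any⇒All¬)
open import Data.List.Relation.Unary.AllPairs using ([]; _∷_)
open import Data.List.Relation.Unary.Unique.Propositional using (Unique)
import Data.List.Relation.Unary.Unique.Propositional.Properties as Unique
open import Data.List.Relation.Binary.Pointwise using (Pointwise; []; _∷_)
open import Data.Product using (Σ; ∃; _×_; _,_; proj₁; proj₂; map₁; uncurry)
open import Data.Sum using (inj₁; inj₂)
open import Function using (_∘_)
open import Relation.Binary.PropositionalEquality hiding ([_])
open import Relation.Nullary using (¬_; Dec; yes; no; contradiction)
open import Relation.Nullary.Decidable using (_×-dec_; ¬?; map′)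
open import Relation.Unary using (Decidable)

module _ {a} {A : Set a} where

  lookup-injective : ∀ {xs : List A} → Unique xs → ∀ {i j} → lookup xs i ≡ lookup xs j → i ≡ j
  lookup-injective {_ ∷ _}  _        {fzero}  {fzero}  _  = refl
  lookup-injective {_ ∷ xs} (x∉ ∷ _) {fzero}  {fsuc j} eq = contradiction eq (All.lookup x∉ (∈-lookup {xs = xs} j))
  lookup-injective {_ ∷ xs} (x∉ ∷ _) {fsuc i} {fzero}  eq = contradiction (sym eq) (All.lookup x∉ (∈-lookup {xs = xs} i))
  lookup-injective {_ ∷ _}  (_ ∷ u)  {fsuc i} {fsuc j} eq = cong fsuc (lookup-injective u eq)

  tabulate-lookup-cast : ∀ {n} (xs : List A) (eq : n ≡ length xs) → tabulate (lookup xs ∘ cast eq) ≡ xs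
  tabulate-lookup-cast xs refl = trans (tabulate-cong (cong (lookup xs) ∘ cast-is-id refl)) (tabulate-lookup xs)

Enumeration : ∀ {n} → List (Fin n) → Set
Enumeration xs = Unique xs × (∀ x → x ∈ xs)

module _ {n : ℕ} where

  unique⇒length≤ : {xs : List (Fin n)} → Unique xs → length xs ≤ n
  unique⇒length≤ u = injective⇒≤ (lookup-injective u)

  enumeration-↔ : {xs : List (Fin n)} → Enumeration xs → Permutation (length xs) n
  enumeration-↔ {xs} (u , complete) =
    permutation (lookup xs) (index ∘ complete) lookup-position (λ i → lookup-injective u (lookup-position (lookup xs i)))
    where
    lookup-position : ∀ x → lookup xs (index (complete x)) ≡ x
    lookup-position x = sym (lookup-index (complete x))

  enumeration⇒permutation : {xs : List (Fin n)} → Enumeration xs →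
                            Σ (Permutation′ n) λ σ → tabulate (σ ⟨$⟩ʳ_) ≡ xs
  enumeration⇒permutation {xs} e = cast-id n≡len ∘ₚ enumeration-↔ e , tabulate-lookup-cast xs n≡len
    where
    n≡len : n ≡ length xs
    n≡len = sym (↔⇒≡ (enumeration-↔ e))

Least : ∀ {p} → (ℕ → Set p) → ℕ → Set p
Least P m = P m × (∀ j → j < m → ¬ P j)

least-witness : ∀ {p} {P : ℕ → Set p} → Decidable P → ∀ {k} → P k → ∃ (Least P)
least-witness {P = P} P? {k} = <-rec (λ k → P k → ∃ (Least P)) search k
  where
  search : ∀ k → (∀ {j} → j < k → P j → ∃ (Least P)) → P k → ∃ (Least P)
  search k smaller pk with anyUpTo? P? k
  ... | yes (j , j<k , pj) = smaller j<k pj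
  ... | no none            = k , pk , λ j j<k pj → none (j , j<k , pj)

module _ {n : ℕ} (G : Graph n) where

  snoc : ∀ {u a b k} → Walk G u a k → adj G a b ≡ true → Walk G u b (suc k)
  snoc (here _)     e = step e (here _)
  snoc (step e′ p) e = step e′ (snoc p e)

  walk? : ∀ k u v → Dec (Walk G u v k)
  walk? zero    u v = map′ (λ { refl → here u }) (λ { (here _) → refl }) (u ≟ᶠ v)
  walk? (suc k) u v = map′ (λ { (w , e , p) → step e p }) (λ { (step e p) → _ , e , p })
                           (any? λ w → adj G u w Bool.≟ true ×-dec walk? k w v)

data Move (A : Set) : Set where
  forward : A → Move A
  back    : Move A

visits : ∀ {A} → List (Move A) → List A
visits []               = []
visits (forward x ∷ ms) = x ∷ visits ms
visits (back ∷ ms)      = visits ms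

data Tour {n} (G : Graph n) : Fin n → List (Fin n) → List (Move (Fin n)) → Set where
  done    : ∀ {t r} → Tour G t r []
  forward : ∀ {t w r ms} → adj G t w ≡ true → Tour G w (t ∷ r) ms → Tour G t r (forward w ∷ ms)
  back    : ∀ {t s r ms} → Tour G s r ms → Tour G t (s ∷ r) (back ∷ ms)

module _ {n : ℕ} {G : Graph n} where

  tour-length : ∀ {t r ms} → Tour G t r ms → length ms ≤ 2 * length (visits ms) + length r
  tour-length done = z≤n
  tour-length {r = r} (forward {ms = ms} _ p) =
    ≤-trans (s≤s (tour-length p)) (≤-reflexive (forward-count (length (visits ms)) (length r)))
    where
    forward-count : ∀ m k → suc (2 * m + suc k) ≡ 2 * suc m + k
    forward-count = solve-∀
  tour-length {r = _ ∷ r} (back {ms = ms} p) =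
    ≤-trans (s≤s (tour-length p)) (≤-reflexive (sym (+-suc (2 * length (visits ms)) (length r))))

data Shift : Set where
  less same more : Shift

act : Shift → ℕ → ℕ
act less c = c ∸ 1
act same c = c
act more c = suc c

shiftTo : ℕ → ℕ → Shift
shiftTo a b with b ℕ.≟ suc a | b ℕ.≟ a
... | yes _ | _     = more
... | no _  | yes _ = same
... | no _  | no _  = less

act-shiftTo : ∀ {a b} → b ≤ suc a → a ≤ suc b → act (shiftTo a b) a ≡ b
act-shiftTo {a} {b} b≤1+a a≤1+b with b ℕ.≟ suc a | b ℕ.≟ a
... | yes b≡1+a | _        = sym b≡1+a
... | no _      | yes b≡a  = sym b≡a
... | no b≢1+a  | no b≢a   = cong (_∸ 1) (≤-antisym a≤1+b (≤∧≢⇒< (≤-pred (≤∧≢⇒< b≤1+a b≢1+a)) b≢a))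

replay : ℕ → List ℕ → List (Move Shift) → List ℕ
replay c st       []               = []
replay c st       (forward δ ∷ ms) = act δ c ∷ replay (act δ c) (c ∷ st) ms
replay c []       (back ∷ ms)      = []
replay c (c′ ∷ st) (back ∷ ms)     = replay c′ st ms

toBits : Move Shift → Bool × Bool
toBits (forward less) = false , false
toBits (forward same) = false , true
toBits (forward more) = true  , false
toBits back           = true  , true

fromBits : Bool → Bool → Move Shift
fromBits false false = forward less
fromBits false true  = forward same
fromBits true  false = forward more
fromBits true  true  = back

fromBits-toBits : ∀ m → uncurry fromBits (toBits m) ≡ m
fromBits-toBits (forward less) = refl
fromBits-toBits (forward same) = refl
fromBits-toBits (forward more) = refl
fromBits-toBits back           = refl

encodeMoves : List (Move Shift) → List Bool
encodeMoves []       = []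
encodeMoves (m ∷ ms) = proj₁ (toBits m) ∷ proj₂ (toBits m) ∷ encodeMoves ms

decodeMoves : List Bool → List (Move Shift)
decodeMoves (a ∷ b ∷ bs) = fromBits a b ∷ decodeMoves bs
decodeMoves _            = []

decodeMoves-encodeMoves : ∀ ms → decodeMoves (encodeMoves ms) ≡ ms
decodeMoves-encodeMoves []       = refl
decodeMoves-encodeMoves (m ∷ ms) = cong₂ _∷_ (fromBits-toBits m) (decodeMoves-encodeMoves ms)

length-encodeMoves : ∀ ms → length (encodeMoves ms) ≡ 2 * length ms
length-encodeMoves []       = refl
length-encodeMoves (m ∷ ms) = trans (cong (2 +_) (length-encodeMoves ms)) (sym (*-suc 2 (length ms)))

-- toBinary w d: the w lowest bits of d, most significant first.
toBinary : ℕ → ℕ → List Bool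
toBinary zero    d = []
toBinary (suc w) d with d <? 2 ^ w
... | yes _ = false ∷ toBinary w d
... | no _  = true  ∷ toBinary w (d ∸ 2 ^ w)

fromBinary : ℕ → List Bool → ℕ × List Bool
fromBinary zero    bs       = 0 , bs
fromBinary (suc w) []       = 0 , []
fromBinary (suc w) (b ∷ bs) = map₁ ((if b then 2 ^ w else 0) +_) (fromBinary w bs)

length-toBinary : ∀ w d → length (toBinary w d) ≡ w
length-toBinary zero    d = refl
length-toBinary (suc w) d with d <? 2 ^ w
... | yes _ = cong suc (length-toBinary w d)
... | no _  = cong suc (length-toBinary w (d ∸ 2 ^ w))

m∸2^n<2^n : ∀ {m n} → m < 2 ^ suc n → 2 ^ n ≤ m → m ∸ 2 ^ n < 2 ^ n
m∸2^n<2^n {m} {n} m<2^[1+n] 2^n≤m =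
  subst (m ∸ 2 ^ n <_) (trans (m+n∸m≡n (2 ^ n) _) (+-identityʳ (2 ^ n))) (∸-monoˡ-< m<2^[1+n] 2^n≤m)

fromBinary-toBinary : ∀ w {d} bs → d < 2 ^ w → fromBinary w (toBinary w d ++ bs) ≡ (d , bs)
fromBinary-toBinary zero    {zero}  bs _         = refl
fromBinary-toBinary zero    {suc d} bs (s≤s ())
fromBinary-toBinary (suc w) {d}    bs d<2^[1+w] with d <? 2 ^ w
... | yes d<2^w rewrite fromBinary-toBinary w bs d<2^w = refl
... | no d≮2^w rewrite fromBinary-toBinary w bs (m∸2^n<2^n {n = w} d<2^[1+w] (≮⇒≥ d≮2^w)) =
  cong (_, bs) (m+[n∸m]≡n (≮⇒≥ d≮2^w))

n<2^[1+⌊log₂n⌋] : ∀ n → n < 2 ^ suc ⌊log₂ n ⌋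
n<2^[1+⌊log₂n⌋] n = ≰⇒> λ 2^[1+⌊log₂n⌋]≤n →
  n≮n ⌊log₂ n ⌋ (subst (_≤ ⌊log₂ n ⌋) (⌊log₂[2^n]⌋≡n (suc ⌊log₂ n ⌋)) (⌊log₂⌋-mono-≤ 2^[1+⌊log₂n⌋]≤n))

decodeLabel : ℕ → List Bool → List ℕ∞
decodeLabel w = uncurry (λ d bs → map just (d ∷ replay d [] (decodeMoves bs))) ∘ fromBinary w

module Distance {n : ℕ} {G : Graph n} (connected : Connected G) where

  shortest : ∀ u v → ∃ (IsDist G u v ∘ just)
  shortest u v = least-witness (λ k → walk? G k u v) (proj₂ (connected u v))

  dist : Fin n → Fin n → ℕ
  dist u v = proj₁ (shortest u v)

  dist-isDist : ∀ u v → IsDist G u v (just (dist u v))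
  dist-isDist u v = proj₂ (shortest u v)

  dist-minimal : ∀ {u v k} → Walk G u v k → dist u v ≤ k
  dist-minimal {u} {v} {k} p = ≮⇒≥ λ k<d → proj₂ (dist-isDist u v) k k<d p

  dist-edgeˡ : ∀ {a b v} → adj G a b ≡ true → dist a v ≤ suc (dist b v)
  dist-edgeˡ {b = b} {v} e = dist-minimal (step e (proj₁ (dist-isDist b v)))

  dist-edgeʳ : ∀ {a b v} → adj G a b ≡ true → dist v b ≤ suc (dist v a)
  dist-edgeʳ {a} {v = v} e = dist-minimal (snoc G (proj₁ (dist-isDist v a)) e)

  dist-pointwise : ∀ v xs → Pointwise (λ d w → IsDist G v w d) (map just (map (dist v) xs)) xs
  dist-pointwise v []       = []
  dist-pointwise v (x ∷ xs) = dist-isDist v x ∷ dist-pointwise v xs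

  tour-depth : ∀ {root t r ms b} → Tour G t r ms → All (λ x → dist x root ≤ b) (t ∷ r) →
               All (λ x → dist x root ≤ b + length (visits ms)) (visits ms)
  tour-depth done _ = []
  tour-depth {root} {t} {b = b} (forward {w = w} {ms = ms} e p) near@(t≤b ∷ _) =
    subst (λ c → All (λ x → dist x root ≤ c) (w ∷ visits ms)) (sym (+-suc b (length (visits ms))))
          (≤-trans w≤ (s≤s (m≤m+n b _)) ∷ tour-depth p (w≤ ∷ All.map m≤n⇒m≤1+n near))
    where
    w≤ : dist w root ≤ suc b
    w≤ = ≤-trans (dist-edgeˡ (trans (Graph.sym G w t) e)) (s≤s t≤b)
  tour-depth (back p) (_ ∷ near) = tour-depth p near

  tourCode : ∀ {t r ms} → Fin n → Tour G t r ms → List (Move Shift)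
  tourCode v done                  = []
  tourCode v (forward {t} {w} _ p) = forward (shiftTo (dist v t) (dist v w)) ∷ tourCode v p
  tourCode v (back p)              = back ∷ tourCode v p

  length-tourCode : ∀ {t r ms} v (p : Tour G t r ms) → length (tourCode v p) ≡ length ms
  length-tourCode v done          = refl
  length-tourCode v (forward _ p) = cong suc (length-tourCode v p)
  length-tourCode v (back p)      = cong suc (length-tourCode v p)

  replay-tourCode : ∀ {t r ms} v (p : Tour G t r ms) →
                    replay (dist v t) (map (dist v) r) (tourCode v p) ≡ map (dist v) (visits ms)
  replay-tourCode v done = refl
  replay-tourCode v (forward {t} {w} e p)
    rewrite act-shiftTo (dist-edgeʳ {v = v} e) (dist-edgeʳ {v = v} (trans (Graph.sym G w t) e)) =
    cong (dist v w ∷_) (replay-tourCode v p)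
  replay-tourCode v (back p) = replay-tourCode v p

module DepthFirst {n : ℕ} {G : Graph n} (connected : Connected G) where
  open import Data.List.Membership.DecPropositional (_≟ᶠ_ {n}) using (_∈?_)

  Closed : List (Fin n) → List (Fin n) → Set
  Closed V S = ∀ {x y} → x ∈ V → x ∉ S → adj G x y ≡ true → y ∈ V

  closed-push : ∀ {V t r w} → Closed V (t ∷ r) → Closed (V ++ [ w ]) (w ∷ t ∷ r)
  closed-push {V} cl x∈ x∉ e with ∈-++⁻ V x∈
  ... | inj₁ x∈V       = ∈-++⁺ˡ (cl x∈V (x∉ ∘ there) e)
  ... | inj₂ (here refl) = contradiction (here refl) x∉

  closed-pop : ∀ {V t r} → Closed V (t ∷ r) → (∀ {y} → adj G t y ≡ true → y ∈ V) → Closed V r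
  closed-pop {t = t} cl t-done {x} x∈ x∉ e with x ≟ᶠ t
  ... | yes refl = t-done e
  ... | no x≢t   = cl x∈ (λ { (here x≡t) → x≢t x≡t ; (there x∈r) → x∉ x∈r }) e

  closed-complete : ∀ {V t} → Closed V [] → t ∈ V → ∀ x → x ∈ V
  closed-complete {V} {t} cl t∈ x = reach (proj₂ (connected t x)) t∈
    where
    reach : ∀ {a b k} → Walk G a b k → a ∈ V → b ∈ V
    reach (here _)   a∈ = a∈
    reach (step e p) a∈ = reach p (cl a∈ (λ ()) e)

  -- k = n - |V| counts the unvisited vertices and makes the recursion terminate.
  dfs : ∀ k {V} → length V + k ≡ n → Unique V → ∀ {t r} → t ∈ V → All (_∈ V) r → Closed V (t ∷ r) →
        ∃ λ ms → Tour G t r ms × Enumeration (V ++ visits ms)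
  dfs k {V} size u {t} t∈ r⊆ cl with any? (λ w → adj G t w Bool.≟ true ×-dec ¬? (w ∈? V))
  dfs zero {V} size u _ _ _ | yes (w , _ , w∉) =
    contradiction (subst (length V <_) size′ (unique⇒length≤ (¬Any⇒All¬ V w∉ ∷ u))) (n≮n (length V))
    where
    size′ : n ≡ length V
    size′ = sym (trans (sym (+-identityʳ (length V))) size)
  dfs (suc k) {V} size u {t} {r} t∈ r⊆ cl | yes (w , e , w∉) =
    let ms , p , enum = dfs k size′ u′ (∈-++⁺ʳ V (here refl)) (∈-++⁺ˡ t∈ ∷ All.map ∈-++⁺ˡ r⊆) (closed-push cl)
    in forward w ∷ ms , forward e p , subst Enumeration (++-assoc V [ w ] (visits ms)) enum
    where
    size′ : length (V ++ [ w ]) + k ≡ n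
    size′ = trans (cong (_+ k) (length-++ V)) (trans (+-assoc (length V) 1 k) size)
    u′ : Unique (V ++ [ w ])
    u′ = Unique.++⁺ u ([] ∷ []) (λ { (w∈V , here refl) → w∉ w∈V })
  dfs k {V} size u {t} t∈ r⊆ cl | no stuck = backtrack r⊆ (closed-pop cl t-done)
    where
    t-done : ∀ {y} → adj G t y ≡ true → y ∈ V
    t-done {y} e with y ∈? V
    ... | yes y∈ = y∈
    ... | no y∉  = contradiction (y , e , y∉) stuck
    backtrack : ∀ {r} → All (_∈ V) r → Closed V r → ∃ λ ms → Tour G t r ms × Enumeration (V ++ visits ms)
    backtrack []         cl′ = [] , done , subst Enumeration (sym (++-identityʳ V)) (u , closed-complete cl′ t∈)
    backtrack (s∈ ∷ r⊆′) cl′ = let ms , p , enum = dfs k size u s∈ r⊆′ cl′ in back ∷ ms , back p , enum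

  depth-first-tour : ∀ {m} → n ≡ suc m → (root : Fin n) →
                     ∃ λ ms → Tour G root [] ms × Enumeration (root ∷ visits ms)
  depth-first-tour {m} n≡ root = dfs m (sym n≡) ([] ∷ []) (here refl) [] (λ x∈ x∉ _ → contradiction x∈ x∉)

module Labelling {n : ℕ} {G : Graph (suc n)} (connected : Connected G)
                 {moves : List (Move (Fin (suc n)))} (tour : Tour G fzero [] moves)
                 (order-enumeration : Enumeration (fzero ∷ visits moves)) where
  open Distance connected

  root : Fin (suc n)
  root = fzero

  width : ℕ
  width = suc ⌊log₂ suc n ⌋

  order : List (Fin (suc n))
  order = root ∷ visits moves

  σ : Permutation′ (suc n)
  σ = proj₁ (enumeration⇒permutation order-enumeration)

  tabulate-σ : tabulate (σ ⟨$⟩ʳ_) ≡ order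
  tabulate-σ = proj₂ (enumeration⇒permutation order-enumeration)

  label : Fin (suc n) → List Bool
  label v = toBinary width (dist v root) ++ encodeMoves (tourCode v tour)

  length-visits : length (visits moves) ≡ n
  length-visits = suc-injective (↔⇒≡ (enumeration-↔ order-enumeration))

  dist-root<2^width : ∀ v → dist v root < 2 ^ width
  dist-root<2^width v =
    ≤-<-trans (All.lookup order-near-root (proj₂ order-enumeration v)) (<-trans (n<1+n n) (n<2^[1+⌊log₂n⌋] (suc n)))
    where
    root≤0 : dist root root ≤ 0
    root≤0 = dist-minimal (here root)
    order-near-root : All (λ x → dist x root ≤ n) order
    order-near-root = ≤-trans root≤0 z≤n
                    ∷ subst (λ b → All (λ x → dist x root ≤ b) (visits moves)) length-visits (tour-depth tour (root≤0 ∷ []))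

  label-length : ∀ v → length (label v) ≤ 4 * suc n + ⌊log₂ suc n ⌋
  label-length v = begin
    length (label v)                 ≡⟨ length-++ (toBinary width (dist v root)) ⟩
    length (toBinary width (dist v root)) + length (encodeMoves (tourCode v tour))
      ≡⟨ cong₂ _+_ (length-toBinary width (dist v root))
                   (trans (length-encodeMoves (tourCode v tour)) (cong (2 *_) (length-tourCode v tour))) ⟩
    width + 2 * length moves         ≤⟨ +-monoʳ-≤ width (*-monoʳ-≤ 2 moves≤) ⟩
    width + 2 * (2 * n)              ≤⟨ m≤m+n _ 3 ⟩
    width + 2 * (2 * n) + 3          ≡⟨ budget ⌊log₂ suc n ⌋ n ⟩
    4 * suc n + ⌊log₂ suc n ⌋        ∎
    where
    open ≤-Reasoning
    moves≤ : length moves ≤ 2 * n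
    moves≤ = subst (length moves ≤_) (trans (+-identityʳ _) (cong (2 *_) length-visits)) (tour-length tour)
    budget : ∀ l n → suc l + 2 * (2 * n) + 3 ≡ 4 * suc n + l
    budget = solve-∀

  decodeLabel-label : ∀ v → decodeLabel width (label v) ≡ map just (map (dist v) order)
  decodeLabel-label v
    rewrite fromBinary-toBinary width (encodeMoves (tourCode v tour)) (dist-root<2^width v)
          | decodeMoves-encodeMoves (tourCode v tour)
    = cong (map just ∘ (dist v root ∷_)) (replay-tourCode v tour)

  correct : ∀ v → Pointwise (λ d w → IsDist G v w d) (decodeLabel width (label v)) (tabulate (σ ⟨$⟩ʳ_))
  correct v rewrite decodeLabel-label v | tabulate-σ = dist-pointwise v order

scheme : ∀ n → DistVecScheme (suc n) (4 * suc n + ⌊log₂ suc n ⌋)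
scheme n = decodeLabel (suc ⌊log₂ suc n ⌋) , λ G connected →
  let ms , tour , order-enumeration = DepthFirst.depth-first-tour connected refl fzero
      open Labelling connected tour order-enumeration
  in σ , label , label-length , correct

theorem2p4 : Σ ℕ λ C → 0 < C × (∀ (n : ℕ) → 2 ≤ n → DistVecScheme n (4 * n + C * ⌊log₂ n ⌋))
theorem2p4 = 1 , s≤s z≤n , λ { (suc n) _ →
  subst (DistVecScheme (suc n)) (cong (4 * suc n +_) (sym (*-identityˡ ⌊log₂ suc n ⌋))) (scheme n) }
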